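{- The variety $\mathcal S$ of all SMB algebras (of arbitrary cardinality) is finitely based, i.e. it is axiomatized by a finite set of identities in the language $\{\wedge,d\}$.
   Context: An algebra $\mathbf A=(A;\wedge,d)$ with a binary operation $\wedge$ and a ternary operation $d$ is idempotent if $x\wedge x=x$ and $d(x,x,x)=x$ for all $x\in A$. For a congruence ${\sim}$ of $\mathbf A$, $\mathbf A$ is an SMB algebra over ${\sim}$ if $\mathbf A$ is idempotent and: (i) $(A/{\sim};\wedge^{\mathbf A/{\sim}})$ is a semilattice; (ii) on each ${\sim}$-class $D$, $\wedge$ restricted to $D$ is the second projection ($x\wedge y=y$ for $x,y\in D$) and $d$ restricted to $D$ is a Mal'cev operation ($d(x,y,y)=x=d(y,y,x)$ for $x,y\in D$). $\mathbf A$ is an SMB algebra if it is an SMB algebra over some congruence of $\mathbf A$. -}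

module Defs where

open import Level using (Level; suc; _⊔_; Setω)
open import Data.Nat using (ℕ)
open import Data.Fin using (Fin)
open import Data.Product using (Σ; _×_; _,_)
open import Data.List using (List)
open import Data.List.Relation.Unary.All using (All)
open import Relation.Binary.PropositionalEquality using (_≡_)
open import Relation.Binary.Core using (Rel)
open import Relation.Binary.Structures using (IsEquivalence)
open import Function.Bundles using (_⇔_)

record Algebra (ℓ : Level) : Set (suc ℓ) where
  field
    Carrier : Set ℓ
    _∧_     : Carrier → Carrier → Carrier
    d       : Carrier → Carrier → Carrier → Carrier

IsIdempotent : ∀ {ℓ} → Algebra ℓ → Set ℓ
IsIdempotent A = ∀ x → (x ∧ x ≡ x) × (d x x x ≡ x)
  where open Algebra A

record IsCongruence {ℓ} (A : Algebra ℓ) (_∼_ : Rel (Algebra.Carrier A) ℓ) : Set ℓ where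
  open Algebra A
  field
    isEquivalence : IsEquivalence _∼_
    ∧-cong : ∀ {x x′ y y′} → x ∼ x′ → y ∼ y′ → (x ∧ y) ∼ (x′ ∧ y′)
    d-cong : ∀ {x x′ y y′ z z′} → x ∼ x′ → y ∼ y′ → z ∼ z′ → d x y z ∼ d x′ y′ z′

-- A is an SMB algebra over the congruence ∼.
-- (i) A/∼ with the induced ∧ is a semilattice: written out on representatives
--     (equality in A/∼ of classes [a],[b] is a ∼ b).
-- (ii) on each ∼-class, ∧ is the second projection and d is Mal'cev.
record IsSMBOver {ℓ} (A : Algebra ℓ) (_∼_ : Rel (Algebra.Carrier A) ℓ) : Set ℓ where
  open Algebra A
  field
    congruence  : IsCongruence A _∼_
    idempotent  : IsIdempotent A
    quot-idem   : ∀ x → (x ∧ x) ∼ x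
    quot-comm   : ∀ x y → (x ∧ y) ∼ (y ∧ x)
    quot-assoc  : ∀ x y z → (x ∧ (y ∧ z)) ∼ ((x ∧ y) ∧ z)
    class-proj  : ∀ {x y} → x ∼ y → x ∧ y ≡ y
    class-malcevˡ : ∀ {x y} → x ∼ y → d x y y ≡ x
    class-malcevʳ : ∀ {x y} → x ∼ y → d y y x ≡ x

IsSMB : ∀ {ℓ} → Algebra ℓ → Set (suc ℓ)
IsSMB {ℓ} A = Σ (Rel (Algebra.Carrier A) ℓ) (IsSMBOver A)

data Term (n : ℕ) : Set where
  var  : Fin n → Term n
  _∧ₜ_ : Term n → Term n → Term n
  dₜ   : Term n → Term n → Term n → Term n

⟦_⟧ : ∀ {ℓ n} → Term n → (A : Algebra ℓ) → (Fin n → Algebra.Carrier A) → Algebra.Carrier A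
⟦ var i ⟧ A ρ = ρ i
⟦ s ∧ₜ t ⟧ A ρ = Algebra._∧_ A (⟦ s ⟧ A ρ) (⟦ t ⟧ A ρ)
⟦ dₜ s t u ⟧ A ρ = Algebra.d A (⟦ s ⟧ A ρ) (⟦ t ⟧ A ρ) (⟦ u ⟧ A ρ)

Identity : Set
Identity = Σ ℕ (λ n → Term n × Term n)

_⊨_ : ∀ {ℓ} → Algebra ℓ → Identity → Set ℓ
A ⊨ (n , s , t) = (ρ : Fin n → Algebra.Carrier A) → ⟦ s ⟧ A ρ ≡ ⟦ t ⟧ A ρ

_⊨*_ : ∀ {ℓ} → Algebra ℓ → List Identity → Set ℓ
A ⊨* E = All (A ⊨_) E

record SMBFinitelyBased : Setω where
  field
    axioms         : List Identity
    characterizes  : ∀ {ℓ} (A : Algebra ℓ) → (A ⊨* axioms) ⇔ IsSMB A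

{-# OPTIONS --safe #-}
-- Within a block ∧ is the second projection, so x ∼ y forces x ∧ y = y and y ∧ x = x;
-- conversely these two equations give [x] = [y] in the semilattice A/∼. So the
-- congruence is determined by ∧: x ∼ y iff x ∧ y = y and y ∧ x = x. Every requirement
-- "s ∼ t" on terms can therefore be written as the identity s ∧ t ≈ t, and finitely
-- many of them (transitivity, compatibility, the semilattice laws up to ∼, the
-- Mal'cev laws) already make this relation an SMB congruence.
module Submission where

open import Defs
open import Data.Nat using (_+_)
open import Data.Fin using (zero; suc)
open import Data.Vec using ([]; _∷_; lookup)
open import Data.Product using (_×_; _,_; proj₁; proj₂)
open import Data.List using (List; []; _∷_)
open import Data.List.Relation.Unary.All using ([]; _∷_)
open import Relation.Binary.PropositionalEquality
  using (_≡_; refl; sym; trans; cong; cong₂; module ≡-Reasoning)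
open import Relation.Binary.Core using (Rel)
open import Relation.Binary.Structures using (IsEquivalence)
open import Function.Bundles using (mk⇔)

-- Apart from idempotence, each law reads s ∧ t = t for a pair s, t that (i) and the
-- compatibility of ∼ place in a common block.
record SMBLaws {ℓ} (A : Algebra ℓ) : Set ℓ where
  open Algebra A
  field
    ∧-idem      : ∀ x → x ∧ x ≡ x
    d-idem      : ∀ x → d x x x ≡ x
    trans-law   : ∀ x y z → ((z ∧ y) ∧ x) ∧ ((x ∧ y) ∧ z) ≡ (x ∧ y) ∧ z
    ∧-cong-law  : ∀ x x′ y y′ → ((x′ ∧ x) ∧ (y′ ∧ y)) ∧ ((x ∧ x′) ∧ (y ∧ y′)) ≡ (x ∧ x′) ∧ (y ∧ y′)
    d-cong-law  : ∀ x x′ y y′ z z′ →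
                  d (x′ ∧ x) (y′ ∧ y) (z′ ∧ z) ∧ d (x ∧ x′) (y ∧ y′) (z ∧ z′) ≡ d (x ∧ x′) (y ∧ y′) (z ∧ z′)
    comm-law    : ∀ x y → (x ∧ y) ∧ (y ∧ x) ≡ y ∧ x
    assocˡ-law  : ∀ x y z → (x ∧ (y ∧ z)) ∧ ((x ∧ y) ∧ z) ≡ (x ∧ y) ∧ z
    assocʳ-law  : ∀ x y z → ((x ∧ y) ∧ z) ∧ (x ∧ (y ∧ z)) ≡ x ∧ (y ∧ z)
    malcevˡ-law : ∀ x y → d (y ∧ x) (x ∧ y) (x ∧ y) ≡ y ∧ x
    malcevʳ-law : ∀ x y → d (x ∧ y) (x ∧ y) (y ∧ x) ≡ y ∧ x

x₀ : ∀ {n} → Term (1 + n)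
x₀ = var zero

x₁ : ∀ {n} → Term (2 + n)
x₁ = var (suc zero)

x₂ : ∀ {n} → Term (3 + n)
x₂ = var (suc (suc zero))

x₃ : ∀ {n} → Term (4 + n)
x₃ = var (suc (suc (suc zero)))

x₄ : ∀ {n} → Term (5 + n)
x₄ = var (suc (suc (suc (suc zero))))

x₅ : ∀ {n} → Term (6 + n)
x₅ = var (suc (suc (suc (suc (suc zero)))))

smbAxioms : List Identity
smbAxioms
  = (1 , x₀ ∧ₜ x₀ , x₀)
  ∷ (1 , dₜ x₀ x₀ x₀ , x₀)
  ∷ (3 , ((x₂ ∧ₜ x₁) ∧ₜ x₀) ∧ₜ ((x₀ ∧ₜ x₁) ∧ₜ x₂) , (x₀ ∧ₜ x₁) ∧ₜ x₂)
  ∷ (4 , ((x₁ ∧ₜ x₀) ∧ₜ (x₃ ∧ₜ x₂)) ∧ₜ ((x₀ ∧ₜ x₁) ∧ₜ (x₂ ∧ₜ x₃)) , (x₀ ∧ₜ x₁) ∧ₜ (x₂ ∧ₜ x₃))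
  ∷ (6 , dₜ (x₁ ∧ₜ x₀) (x₃ ∧ₜ x₂) (x₅ ∧ₜ x₄) ∧ₜ dₜ (x₀ ∧ₜ x₁) (x₂ ∧ₜ x₃) (x₄ ∧ₜ x₅)
       , dₜ (x₀ ∧ₜ x₁) (x₂ ∧ₜ x₃) (x₄ ∧ₜ x₅))
  ∷ (2 , (x₀ ∧ₜ x₁) ∧ₜ (x₁ ∧ₜ x₀) , x₁ ∧ₜ x₀)
  ∷ (3 , (x₀ ∧ₜ (x₁ ∧ₜ x₂)) ∧ₜ ((x₀ ∧ₜ x₁) ∧ₜ x₂) , (x₀ ∧ₜ x₁) ∧ₜ x₂)
  ∷ (3 , ((x₀ ∧ₜ x₁) ∧ₜ x₂) ∧ₜ (x₀ ∧ₜ (x₁ ∧ₜ x₂)) , x₀ ∧ₜ (x₁ ∧ₜ x₂))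
  ∷ (2 , dₜ (x₁ ∧ₜ x₀) (x₀ ∧ₜ x₁) (x₀ ∧ₜ x₁) , x₁ ∧ₜ x₀)
  ∷ (2 , dₜ (x₀ ∧ₜ x₁) (x₀ ∧ₜ x₁) (x₁ ∧ₜ x₀) , x₁ ∧ₜ x₀)
  ∷ []

module _ {ℓ} {A : Algebra ℓ} where
  laws⇒⊨smbAxioms : SMBLaws A → A ⊨* smbAxioms
  laws⇒⊨smbAxioms L
    = (λ ρ → ∧-idem (ρ zero))
    ∷ (λ ρ → d-idem (ρ zero))
    ∷ (λ ρ → trans-law _ _ _)
    ∷ (λ ρ → ∧-cong-law _ _ _ _)
    ∷ (λ ρ → d-cong-law _ _ _ _ _ _)
    ∷ (λ ρ → comm-law _ _)
    ∷ (λ ρ → assocˡ-law _ _ _)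
    ∷ (λ ρ → assocʳ-law _ _ _)
    ∷ (λ ρ → malcevˡ-law _ _)
    ∷ (λ ρ → malcevʳ-law _ _)
    ∷ []
    where open SMBLaws L

  ⊨smbAxioms⇒laws : A ⊨* smbAxioms → SMBLaws A
  ⊨smbAxioms⇒laws (⊨∧-idem ∷ ⊨d-idem ∷ ⊨trans ∷ ⊨∧-cong ∷ ⊨d-cong ∷ ⊨comm ∷ ⊨assocˡ ∷ ⊨assocʳ
                   ∷ ⊨malcevˡ ∷ ⊨malcevʳ ∷ []) = record
    { ∧-idem      = λ x → ⊨∧-idem (lookup (x ∷ []))
    ; d-idem      = λ x → ⊨d-idem (lookup (x ∷ []))
    ; trans-law   = λ x y z → ⊨trans (lookup (x ∷ y ∷ z ∷ []))
    ; ∧-cong-law  = λ x x′ y y′ → ⊨∧-cong (lookup (x ∷ x′ ∷ y ∷ y′ ∷ []))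
    ; d-cong-law  = λ x x′ y y′ z z′ → ⊨d-cong (lookup (x ∷ x′ ∷ y ∷ y′ ∷ z ∷ z′ ∷ []))
    ; comm-law    = λ x y → ⊨comm (lookup (x ∷ y ∷ []))
    ; assocˡ-law  = λ x y z → ⊨assocˡ (lookup (x ∷ y ∷ z ∷ []))
    ; assocʳ-law  = λ x y z → ⊨assocʳ (lookup (x ∷ y ∷ z ∷ []))
    ; malcevˡ-law = λ x y → ⊨malcevˡ (lookup (x ∷ y ∷ []))
    ; malcevʳ-law = λ x y → ⊨malcevʳ (lookup (x ∷ y ∷ []))
    }

module _ {ℓ} {A : Algebra ℓ} {_∼_ : Rel (Algebra.Carrier A) ℓ} (S : IsSMBOver A _∼_) where
  open Algebra A
  open IsSMBOver S
  open IsCongruence congruence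
  open IsEquivalence isEquivalence renaming (refl to ∼-refl; sym to ∼-sym; trans to ∼-trans)

  smbOver⇒laws : SMBLaws A
  smbOver⇒laws = record
    { ∧-idem      = λ x → proj₁ (idempotent x)
    ; d-idem      = λ x → proj₂ (idempotent x)
    ; trans-law   = λ x y z → class-proj
        (∼-trans (quot-comm (z ∧ y) x) (∼-trans (∧-cong ∼-refl (quot-comm z y)) (quot-assoc x y z)))
    ; ∧-cong-law  = λ _ _ _ _ → class-proj (∧-cong (quot-comm _ _) (quot-comm _ _))
    ; d-cong-law  = λ _ _ _ _ _ _ → class-proj (d-cong (quot-comm _ _) (quot-comm _ _) (quot-comm _ _))
    ; comm-law    = λ x y → class-proj (quot-comm x y)
    ; assocˡ-law  = λ x y z → class-proj (quot-assoc x y z)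
    ; assocʳ-law  = λ x y z → class-proj (∼-sym (quot-assoc x y z))
    ; malcevˡ-law = λ x y → class-malcevˡ (quot-comm y x)
    ; malcevʳ-law = λ x y → class-malcevʳ (quot-comm y x)
    }

module Absorption {ℓ} (A : Algebra ℓ) where
  open Algebra A

  _≋_ : Rel Carrier ℓ
  x ≋ y = (x ∧ y ≡ y) × (y ∧ x ≡ x)

  ≋-sym : ∀ {x y} → x ≋ y → y ≋ x
  ≋-sym (x∧y≡y , y∧x≡x) = y∧x≡x , x∧y≡y

module _ {ℓ} {A : Algebra ℓ} (L : SMBLaws A) where
  open Algebra A
  open Absorption A
  open SMBLaws L
  open ≡-Reasoning

  ≋-trans⇒∧≡ : ∀ {x y z} → x ≋ y → y ≋ z → x ∧ z ≡ z
  ≋-trans⇒∧≡ {x} {y} {z} (x∧y≡y , y∧x≡x) (y∧z≡z , z∧y≡y) = begin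
    x ∧ z                         ≡⟨ cong₂ _∧_ (sym zyx≡x) (sym xyz≡z) ⟩
    ((z ∧ y) ∧ x) ∧ ((x ∧ y) ∧ z) ≡⟨ trans-law x y z ⟩
    (x ∧ y) ∧ z                   ≡⟨ xyz≡z ⟩
    z                             ∎
    where
    zyx≡x : (z ∧ y) ∧ x ≡ x
    zyx≡x = trans (cong (_∧ x) z∧y≡y) y∧x≡x
    xyz≡z : (x ∧ y) ∧ z ≡ z
    xyz≡z = trans (cong (_∧ z) x∧y≡y) y∧z≡z

  ≋-isEquivalence : IsEquivalence _≋_
  ≋-isEquivalence = record
    { refl  = λ {x} → ∧-idem x , ∧-idem x
    ; sym   = ≋-sym
    ; trans = λ p q → ≋-trans⇒∧≡ p q , ≋-trans⇒∧≡ (≋-sym q) (≋-sym p)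
    }

  ∧-cong⇒∧≡ : ∀ {x x′ y y′} → x ≋ x′ → y ≋ y′ → (x ∧ y) ∧ (x′ ∧ y′) ≡ x′ ∧ y′
  ∧-cong⇒∧≡ {x} {x′} {y} {y′} (x∧x′≡x′ , x′∧x≡x) (y∧y′≡y′ , y′∧y≡y) = begin
    (x ∧ y) ∧ (x′ ∧ y′)
      ≡⟨ sym (cong₂ _∧_ (cong₂ _∧_ x′∧x≡x y′∧y≡y) (cong₂ _∧_ x∧x′≡x′ y∧y′≡y′)) ⟩
    ((x′ ∧ x) ∧ (y′ ∧ y)) ∧ ((x ∧ x′) ∧ (y ∧ y′))
      ≡⟨ ∧-cong-law x x′ y y′ ⟩
    (x ∧ x′) ∧ (y ∧ y′)
      ≡⟨ cong₂ _∧_ x∧x′≡x′ y∧y′≡y′ ⟩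
    x′ ∧ y′ ∎

  d-cong⇒∧≡ : ∀ {x x′ y y′ z z′} → x ≋ x′ → y ≋ y′ → z ≋ z′ → d x y z ∧ d x′ y′ z′ ≡ d x′ y′ z′
  d-cong⇒∧≡ {x} {x′} {y} {y′} {z} {z′}
            (x∧x′≡x′ , x′∧x≡x) (y∧y′≡y′ , y′∧y≡y) (z∧z′≡z′ , z′∧z≡z) = begin
    d x y z ∧ d x′ y′ z′
      ≡⟨ sym (cong₂ _∧_ (d-cong x′∧x≡x y′∧y≡y z′∧z≡z) (d-cong x∧x′≡x′ y∧y′≡y′ z∧z′≡z′)) ⟩
    d (x′ ∧ x) (y′ ∧ y) (z′ ∧ z) ∧ d (x ∧ x′) (y ∧ y′) (z ∧ z′)
      ≡⟨ d-cong-law x x′ y y′ z z′ ⟩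
    d (x ∧ x′) (y ∧ y′) (z ∧ z′)
      ≡⟨ d-cong x∧x′≡x′ y∧y′≡y′ z∧z′≡z′ ⟩
    d x′ y′ z′ ∎
    where
    d-cong : ∀ {a a′ b b′ c c′} → a ≡ a′ → b ≡ b′ → c ≡ c′ → d a b c ≡ d a′ b′ c′
    d-cong refl refl refl = refl

  ≋-isCongruence : IsCongruence A _≋_
  ≋-isCongruence = record
    { isEquivalence = ≋-isEquivalence
    ; ∧-cong        = λ p q → ∧-cong⇒∧≡ p q , ∧-cong⇒∧≡ (≋-sym p) (≋-sym q)
    ; d-cong        = λ p q r → d-cong⇒∧≡ p q r , d-cong⇒∧≡ (≋-sym p) (≋-sym q) (≋-sym r)
    }

  laws⇒smbOver : IsSMBOver A _≋_
  laws⇒smbOver = record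
    { congruence    = ≋-isCongruence
    ; idempotent    = λ x → ∧-idem x , d-idem x
    ; quot-idem     = λ x → trans (cong (_∧ x) (∧-idem x)) (∧-idem x) , cong (x ∧_) (∧-idem x)
    ; quot-comm     = λ x y → comm-law x y , comm-law y x
    ; quot-assoc    = λ x y z → assocˡ-law x y z , assocʳ-law x y z
    ; class-proj    = proj₁
    ; class-malcevˡ = λ {x} {y} (x∧y≡y , y∧x≡x) →
        trans (sym (cong₂ (λ u v → d u v v) y∧x≡x x∧y≡y)) (trans (malcevˡ-law x y) y∧x≡x)
    ; class-malcevʳ = λ {x} {y} (x∧y≡y , y∧x≡x) →
        trans (sym (cong₂ (λ u v → d u u v) x∧y≡y y∧x≡x)) (trans (malcevʳ-law x y) y∧x≡x)
    }

corollary4p4 : SMBFinitelyBased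
corollary4p4 = record
  { axioms        = smbAxioms
  ; characterizes = λ A → mk⇔
      (λ A⊨smbAxioms → _ , laws⇒smbOver (⊨smbAxioms⇒laws A⊨smbAxioms))
      (λ (_ , smbOver) → laws⇒⊨smbAxioms (smbOver⇒laws smbOver))
  }
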